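{- Let $G$ be a block graph. Then $\operatorname{cobox}(G) \leq \operatorname{cothdim}(G) \leq 2\,\operatorname{cobox}(G)$.
   Context: All graphs are finite and simple. The boxicity $\operatorname{box}(H)$ of a graph $H$ is the minimum dimension $d$ such that $H$ is the intersection graph of a family of axis-parallel boxes in $\mathbb{R}^d$; the co-boxicity of $G$ is $\operatorname{cobox}(G)=\operatorname{box}(\overline{G})$. A threshold graph is a graph that is either a single isolated vertex or is obtained from a smaller threshold graph by adding an isolated vertex or a universal vertex. A threshold cover of $G$ is a collection of subgraphs of $G$ that are threshold graphs whose edge sets have union $E(G)$; $\operatorname{cothdim}(G)$ is the minimum size of a threshold cover of $G$. A block of a graph is a maximal $2$-connected subgraph (a maximal connected subgraph without a cut-vertex; bridges with their endpoints are blocks). A block graph is a graph in which every block is a complete graph.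
   Formalization: The axis-parallel boxes in the definition of $\operatorname{cobox}(G)$ have rational endpoints, lying in ℚ^d instead of $\mathbb{R}^d$. -}

module Defs where

open import Level using (0ℓ)
open import Data.Nat using (ℕ; _≤_)
open import Data.Fin using (Fin)
open import Data.Product using (Σ; _×_; ∃; _,_)
open import Data.List using (List; []; _∷_)
open import Data.List.Membership.Propositional using (_∈_; _∉_)
open import Data.Rational as ℚ using (ℚ)
open import Relation.Nullary using (¬_)
open import Relation.Binary.PropositionalEquality using (_≡_; _≢_)
open import Function.Bundles using (_⇔_)

record Graph (n : ℕ) : Set₁ where
  field
    Adj    : Fin n → Fin n → Set
    sym    : ∀ {u v} → Adj u v → Adj v u
    irrefl : ∀ {u} → ¬ Adj u u
open Graph public

complement : ∀ {n} → Graph n → Graph n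
complement G = record
  { Adj    = λ u v → (u ≢ v) × ¬ Adj G u v
  ; sym    = λ { (u≢v , ¬a) → (λ e → u≢v (Relation.Binary.PropositionalEquality.sym e))
                             , (λ a → ¬a (Graph.sym G a)) }
  ; irrefl = λ { (u≢u , _) → u≢u Relation.Binary.PropositionalEquality.refl }
  }

IsMinimum : (ℕ → Set₁) → ℕ → Set₁
IsMinimum P k = P k × (∀ m → P m → k ≤ m)

-- A box in ℚ^d: closed interval [lo i , hi i] in each coordinate i.
-- H is the intersection graph of the boxes (lo v , hi v), v ∈ V(H).
record BoxRep {n} (H : Graph n) (d : ℕ) : Set₁ where
  field
    lo hi  : Fin n → Fin d → ℚ
    wf     : ∀ v i → lo v i ℚ.≤ hi v i
    represents : ∀ u v → u ≢ v →
      Adj H u v ⇔ (∀ i → (lo u i ℚ.≤ hi v i) × (lo v i ℚ.≤ hi u i))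

IsBoxicity : ∀ {n} → Graph n → ℕ → Set₁
IsBoxicity H = IsMinimum (BoxRep H)

IsCoBoxicity : ∀ {n} → Graph n → ℕ → Set₁
IsCoBoxicity G = IsBoxicity (complement G)

-- Threshold E vs : the graph with vertex set the elements of vs and edge
-- relation E (restricted to them) is a threshold graph, built by adding
-- the vertices of vs from right to left: the last one is the initial
-- single vertex, each further vertex is added as an isolated or as a
-- universal vertex.
data Threshold {V : Set} (E : V → V → Set) : List V → Set where
  single : ∀ v → Threshold E (v ∷ [])
  addIsolated  : ∀ v vs → Threshold E vs → v ∉ vs →
                 (∀ w → w ∈ vs → ¬ E v w) → Threshold E (v ∷ vs)
  addUniversal : ∀ v vs → Threshold E vs → v ∉ vs →
                 (∀ w → w ∈ vs → E v w) → Threshold E (v ∷ vs)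

record ThresholdSubgraph {n} (G : Graph n) : Set₁ where
  field
    verts     : List (Fin n)
    E         : Fin n → Fin n → Set
    E-sym     : ∀ {u v} → E u v → E v u
    E-sub     : ∀ {u v} → E u v → Adj G u v
    E-verts   : ∀ {u v} → E u v → (u ∈ verts) × (v ∈ verts)
    threshold : Threshold E verts

record ThresholdCover {n} (G : Graph n) (k : ℕ) : Set₁ where
  field
    part  : Fin k → ThresholdSubgraph G
    cover : ∀ u v → Adj G u v → ∃ λ i → ThresholdSubgraph.E (part i) u v

IsCoThresholdDim : ∀ {n} → Graph n → ℕ → Set₁
IsCoThresholdDim G = IsMinimum (ThresholdCover G)

VSet : ℕ → Set₁
VSet n = Fin n → Set

data Reach {n} (G : Graph n) (S : VSet n) : Fin n → Fin n → Set where
  here : ∀ {u} → S u → Reach G S u u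
  step : ∀ {u w v} → S u → Adj G u w → Reach G S w v → Reach G S u v

Connected : ∀ {n} → Graph n → VSet n → Set
Connected G S = (∃ λ v → S v) × (∀ u v → S u → S v → Reach G S u v)

_∖₁_ : ∀ {n} → VSet n → Fin n → VSet n
(S ∖₁ x) v = S v × v ≢ x

NoCutVertex : ∀ {n} → Graph n → VSet n → Set
NoCutVertex G S = ∀ x → S x → ∀ u v → (S ∖₁ x) u → (S ∖₁ x) v → Reach G (S ∖₁ x) u v

Nonseparable : ∀ {n} → Graph n → VSet n → Set
Nonseparable G S = Connected G S × NoCutVertex G S

_⊆ᵥ_ : ∀ {n} → VSet n → VSet n → Set
S ⊆ᵥ T = ∀ v → S v → T v

-- a block: a maximal connected subgraph without a cut-vertex
-- (blocks are induced subgraphs, so we identify them with vertex sets)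
IsBlock : ∀ {n} → Graph n → VSet n → Set₁
IsBlock {n} G B = Nonseparable G B × (∀ (T : VSet n) → B ⊆ᵥ T → Nonseparable G T → T ⊆ᵥ B)

IsBlockGraph : ∀ {n} → Graph n → Set₁
IsBlockGraph {n} G = ∀ (B : VSet n) → IsBlock G B → ∀ u v → B u → B v → u ≢ v → Adj G u v

{-# OPTIONS --safe #-}
-- Lower bound: a threshold graph is the complement of an interval graph.
-- Building it vertex by vertex, a vertex added to k earlier ones gets the
-- interval [0, k] if it is isolated and [k, k] if it is universal, while all
-- earlier intervals lie inside [0, k - 1].  One coordinate per part of a
-- threshold cover of G (vertices outside the part getting the whole range)
-- therefore gives a box representation of the complement of G.
--
-- Upper bound: in a box representation of the complement of G the edges of G
-- are the pairs of boxes that are separated in some coordinate.  Fix a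
-- coordinate, let x be the vertex whose interval ends first and y the one
-- whose interval starts last.  The separated pairs containing y form a star
-- at y.  Any other separated pair {u, w} with u ending before w starts is
-- either an edge at x or lies on the 4-cycle x w u y; in a block graph a
-- 4-cycle lies in one block, hence has both chords, so then u and w are common
-- neighbours of x and y.  Those common neighbours form a clique, and together
-- with the other vertices starting after x ends they make a threshold graph
-- with apex x.  So two threshold graphs per coordinate suffice.
module Submission where

open import Defs
open import Data.Nat using (ℕ; _≤_; _*_)
open import Data.Product using (_×_)

open import Level using (0ℓ)
open import Data.Empty using (⊥; ⊥-elim)
open import Data.Unit using (⊤; tt)
open import Data.Nat using (zero; suc; _<_; z≤n; _≤?_)
open import Data.Nat.Properties using (≤-trans; <⇒≤; <⇒≱; n<1+n; m<n⇒m<1+n; ≤-refl)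
open import Data.Integer as ℤ using (+_; +≤+)
import Data.Integer.Properties as ℤₚ
open import Data.Rational as ℚ using (ℚ; *≤*)
open import Data.Rational.Literals using (fromℤ)
import Data.Rational.Properties as ℚₚ
open import Data.Fin using (Fin; zero; suc; _≟_; remQuot; combine)
open import Data.Fin.Properties using (all?; ¬∀⟶∃¬; remQuot-combine; sequence)
open import Data.List using (List; []; _∷_; _++_; length; filter; allFin)
open import Data.List.Membership.Propositional using (_∈_; _∉_)
open import Data.List.Membership.Propositional.Properties
  using (∈-filter⁺; ∈-filter⁻; ∈-allFin; ∈-++⁺ˡ; ∈-++⁺ʳ; ∈-++⁻)
open import Data.List.Relation.Unary.Any using (here; there; tail)
import Data.List.Relation.Unary.All as All
open import Data.List.Relation.Unary.All.Properties.Core using (All¬⇒¬Any)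
open import Data.List.Relation.Unary.AllPairs using (_∷_)
open import Data.List.Relation.Unary.Unique.Propositional using (Unique)
import Data.List.Relation.Unary.Unique.Propositional.Properties as Unique
open import Relation.Binary.Bundles using (DecTotalOrder)
open import Data.List.Extrema (DecTotalOrder.totalOrder ℚₚ.≤-decTotalOrder)
  using (argmin; argmax; f[argmin]≤f[xs]; f[xs]≤f[argmax])
open import Data.Product using (Σ; ∃; ∃₂; _,_; proj₁; proj₂; swap; uncurry; map)
open import Data.Sum as Sum using (_⊎_; inj₁; inj₂; [_,_])
open import Function using (_∘_; id)
open import Function.Bundles using (mk⇔; Equivalence)
open import Effect.Applicative using (RawApplicative)
open import Effect.Monad using (RawMonad)
open import Relation.Binary.Definitions using (DecidableEquality)
open import Relation.Binary.PropositionalEquality as ≡ using (_≡_; _≢_; refl; subst; subst₂)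
open import Relation.Nullary using (¬_; Dec; yes; no; ¬?)
open import Relation.Nullary.Decidable using (decidable-stable; _×-dec_; ¬¬-excluded-middle)
open import Relation.Nullary.Negation using (DoubleNegation; ¬¬-Monad; ¬¬-map)
open import Relation.Unary using (Pred; Decidable)

toℚ : ℕ → ℚ
toℚ n = fromℤ (+ n)

toℚ-mono-≤ : ∀ {m n} → m ≤ n → toℚ m ℚ.≤ toℚ n
toℚ-mono-≤ {m} {n} m≤n =
  *≤* (subst₂ ℤ._≤_ (≡.sym (ℤₚ.*-identityʳ (+ m))) (≡.sym (ℤₚ.*-identityʳ (+ n))) (+≤+ m≤n))

toℚ-cancel-≤ : ∀ {m n} → toℚ m ℚ.≤ toℚ n → m ≤ n
toℚ-cancel-≤ {m} {n} (*≤* le) =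
  ℤₚ.drop‿+≤+ (subst₂ ℤ._≤_ (ℤₚ.*-identityʳ (+ m)) (ℤₚ.*-identityʳ (+ n)) le)

<⇒≱ℚ : ∀ {p q} → p ℚ.< q → ¬ q ℚ.≤ p
<⇒≱ℚ p<q q≤p = ℚₚ.<-irrefl refl (ℚₚ.<-≤-trans p<q q≤p)

adjacent⇒≢ : ∀ {n} (G : Graph n) {u v} → Adj G u v → u ≢ v
adjacent⇒≢ G uv refl = irrefl G uv

module _ {V : Set} {E : V → V → Set} where

  Threshold⁰ : List V → Set
  Threshold⁰ []       = ⊤
  Threshold⁰ (v ∷ vs) = Threshold E (v ∷ vs)

  ∷-isolated : ∀ {v vs} → Threshold⁰ vs → v ∉ vs → (∀ w → w ∈ vs → ¬ E v w) →
               Threshold E (v ∷ vs)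
  ∷-isolated {v} {[]}     _ _  _   = single v
  ∷-isolated {v} {w ∷ ws} t v∉ iso = addIsolated v (w ∷ ws) t v∉ iso

  ∷-universal : ∀ {v vs} → Threshold⁰ vs → v ∉ vs → (∀ w → w ∈ vs → E v w) →
                Threshold E (v ∷ vs)
  ∷-universal {v} {[]}     _ _  _   = single v
  ∷-universal {v} {w ∷ ws} t v∉ uni = addUniversal v (w ∷ ws) t v∉ uni

  ++-isolated : ∀ us {vs} → Unique (us ++ vs) →
                (∀ u w → u ∈ us → w ∈ us ++ vs → ¬ E u w) →
                Threshold⁰ vs → Threshold⁰ (us ++ vs)
  ++-isolated []       _           _   t = t
  ++-isolated (u ∷ us) (u∉ ∷ uniq) iso t =
    ∷-isolated (++-isolated us uniq (λ v w v∈ w∈ → iso v w (there v∈) (there w∈)) t)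
               (All¬⇒¬Any u∉) (λ w w∈ → iso u w (here refl) (there w∈))

  clique⁰ : ∀ vs → Unique vs → (∀ u w → u ∈ vs → w ∈ vs → u ≢ w → E u w) → Threshold⁰ vs
  clique⁰ []       _           _   = tt
  clique⁰ (v ∷ vs) (v∉ ∷ uniq) adj =
    ∷-universal (clique⁰ vs uniq (λ u w u∈ w∈ → adj u w (there u∈) (there w∈)))
                (All¬⇒¬Any v∉) (λ w w∈ → adj v w (here refl) (there w∈) (All.lookup v∉ w∈))

Interval : Set
Interval = ℕ × ℕ

Overlap : Interval → Interval → Set
Overlap I J = proj₁ I ≤ proj₂ J × proj₁ J ≤ proj₂ I

Represents : Set → Interval → Interval → Set
Represents e I J = (e → ¬ Overlap I J) × (¬ e → Overlap I J)

Represents-flip : ∀ {e e′ I J} → (e′ → e) → (e → e′) → Represents e J I → Represents e′ I J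
Represents-flip f g (disjoint , overlaps) =
  (λ x o → disjoint (f x) (swap o)) , (λ ¬x → swap (overlaps (¬x ∘ g)))

Below : ℕ → Interval → Set
Below k I = proj₁ I ≤ proj₂ I × proj₂ I < k

Below⇒Overlap-whole : ∀ {k I} → Below k I → Overlap I (0 , k)
Below⇒Overlap-whole (lo≤hi , hi<k) = ≤-trans lo≤hi (<⇒≤ hi<k) , z≤n

module ThresholdIntervals {V : Set} (_≟ᵥ_ : DecidableEquality V)
                          {E : V → V → Set} (E-sym : ∀ {u w} → E u w → E w u) where

  interval : ∀ {vs} → Threshold E vs → V → Interval
  interval (single _) _ = 0 , 0
  interval (addIsolated v vs t _ _) u with u ≟ᵥ v
  ... | yes _ = 0 , length vs
  ... | no  _ = interval t u
  interval (addUniversal v vs t _ _) u with u ≟ᵥ v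
  ... | yes _ = length vs , length vs
  ... | no  _ = interval t u

  interval-below : ∀ {vs} (t : Threshold E vs) u → Below (length vs) (interval t u)
  interval-below (single _) _ = z≤n , n<1+n 0
  interval-below (addIsolated v vs t _ _) u with u ≟ᵥ v
  ... | yes _ = z≤n , n<1+n _
  ... | no  _ = map id m<n⇒m<1+n (interval-below t u)
  interval-below (addUniversal v vs t _ _) u with u ≟ᵥ v
  ... | yes _ = ≤-refl , n<1+n _
  ... | no  _ = map id m<n⇒m<1+n (interval-below t u)

  isolated-represents : ∀ {e k I} → ¬ e → Below k I → Represents e (0 , k) I
  isolated-represents ¬e below = (λ e _ → ¬e e) , (λ _ → swap (Below⇒Overlap-whole below))

  universal-represents : ∀ {e k I} → e → Below k I → Represents e (k , k) I
  universal-represents e (_ , hi<k) = (λ _ (k≤hi , _) → <⇒≱ hi<k k≤hi) , (λ ¬e → ⊥-elim (¬e e))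

  interval-represents : ∀ {vs} (t : Threshold E vs) {u w} → u ∈ vs → w ∈ vs → u ≢ w →
                        Represents (E u w) (interval t u) (interval t w)
  interval-represents (single _) (here refl) (here refl) u≢w = ⊥-elim (u≢w refl)
  interval-represents (addIsolated v vs t _ iso) {u} {w} u∈ w∈ u≢w with u ≟ᵥ v | w ≟ᵥ v
  ... | yes refl | yes refl = ⊥-elim (u≢w refl)
  ... | yes refl | no w≢v = isolated-represents (iso w (tail w≢v w∈)) (interval-below t w)
  ... | no u≢v | yes refl =
    Represents-flip E-sym E-sym (isolated-represents (iso u (tail u≢v u∈)) (interval-below t u))
  ... | no u≢v | no w≢v = interval-represents t (tail u≢v u∈) (tail w≢v w∈) u≢w
  interval-represents (addUniversal v vs t _ uni) {u} {w} u∈ w∈ u≢w with u ≟ᵥ v | w ≟ᵥ v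
  ... | yes refl | yes refl = ⊥-elim (u≢w refl)
  ... | yes refl | no w≢v = universal-represents (uni w (tail w≢v w∈)) (interval-below t w)
  ... | no u≢v | yes refl =
    Represents-flip E-sym E-sym (universal-represents (uni u (tail u≢v u∈)) (interval-below t u))
  ... | no u≢v | no w≢v = interval-represents t (tail u≢v u∈) (tail w≢v w∈) u≢w

module ThresholdSubgraphIntervals {n} {G : Graph n} (S : ThresholdSubgraph G) where
  open ThresholdSubgraph S
  open ThresholdIntervals (_≟_ {n}) {E} E-sym
  open import Data.List.Membership.DecPropositional (_≟_ {n}) using (_∈?_)

  interval⁺ : Fin n → Interval
  interval⁺ u with u ∈? verts
  ... | yes _ = interval threshold u
  ... | no  _ = 0 , length verts

  interval⁺-below : ∀ u → Below (suc (length verts)) (interval⁺ u)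
  interval⁺-below u with u ∈? verts
  ... | yes _ = map id m<n⇒m<1+n (interval-below threshold u)
  ... | no  _ = z≤n , n<1+n _

  interval⁺-represents : ∀ u w → u ≢ w → Represents (E u w) (interval⁺ u) (interval⁺ w)
  interval⁺-represents u w u≢w with u ∈? verts | w ∈? verts
  ... | yes u∈ | yes w∈ = interval-represents threshold u∈ w∈ u≢w
  ... | yes _  | no w∉ =
    (λ e _ → w∉ (proj₂ (E-verts e))) , (λ _ → Below⇒Overlap-whole (interval-below threshold u))
  ... | no u∉  | yes _ =
    (λ e _ → u∉ (proj₁ (E-verts e))) , (λ _ → swap (Below⇒Overlap-whole (interval-below threshold w)))
  ... | no u∉  | no _ = (λ e _ → u∉ (proj₁ (E-verts e))) , (λ _ → z≤n , z≤n)

thresholdCover⇒boxRep : ∀ {n} {G : Graph n} {t} → ThresholdCover G t → BoxRep (complement G) t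
thresholdCover⇒boxRep {n} {t = t} C = record
  { lo = λ u i → toℚ (proj₁ (I i u))
  ; hi = λ u i → toℚ (proj₂ (I i u))
  ; wf = λ u i → toℚ-mono-≤ (proj₁ (interval⁺-below (part i) u))
  ; represents = λ u v u≢v → mk⇔
      (λ (_ , ¬uv) i → map toℚ-mono-≤ toℚ-mono-≤
         (proj₂ (interval⁺-represents (part i) u v u≢v) (¬uv ∘ ThresholdSubgraph.E-sub (part i))))
      (λ overlaps → u≢v , λ uv → let (i , e) = cover u v uv in
         proj₁ (interval⁺-represents (part i) u v u≢v) e (map toℚ-cancel-≤ toℚ-cancel-≤ (overlaps i)))
  }
  where
  open ThresholdCover C
  open ThresholdSubgraphIntervals
  I : Fin t → Fin n → Interval
  I i = interval⁺ (part i)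

module Walk {n} (G : Graph n) where
  open import Data.List.Membership.DecPropositional (_≟_ {n}) using (_∈?_)

  vertices : ∀ {S u v} → Reach G S u v → List (Fin n)
  vertices (here {u} _)     = u ∷ []
  vertices (step {u} _ _ p) = u ∷ vertices p

  vertices-inside : ∀ {S u v w} (p : Reach G S u v) → w ∈ vertices p → S w
  vertices-inside (here s)     (here refl) = s
  vertices-inside (step s _ _) (here refl) = s
  vertices-inside (step _ _ p) (there w∈)  = vertices-inside p w∈

  start-inside : ∀ {S u v} → Reach G S u v → S u
  start-inside (here s)     = s
  start-inside (step s _ _) = s

  end∈vertices : ∀ {S u v} (p : Reach G S u v) → v ∈ vertices p
  end∈vertices (here _)     = here refl
  end∈vertices (step _ _ p) = there (end∈vertices p)

  end-inside : ∀ {S u v} (p : Reach G S u v) → S v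
  end-inside p = vertices-inside p (end∈vertices p)

  restrict : ∀ {S S′ u v} (p : Reach G S u v) → (∀ {w} → w ∈ vertices p → S′ w) → Reach G S′ u v
  restrict (here _)     inside = here (inside (here refl))
  restrict (step _ a p) inside = step (inside (here refl)) a (restrict p (λ w∈ → inside (there w∈)))

  weaken : ∀ {S S′ u v} → S ⊆ᵥ S′ → Reach G S u v → Reach G S′ u v
  weaken S⊆S′ p = restrict p (λ w∈ → S⊆S′ _ (vertices-inside p w∈))

  avoiding : ∀ {S u v z} (p : Reach G S u v) → z ∉ vertices p → Reach G (_≢ z) u v
  avoiding p z∉ = restrict p (λ w∈ w≡z → z∉ (subst (_∈ vertices p) w≡z w∈))

  _++ʳ_ : ∀ {S u v w} → Reach G S u v → Reach G S v w → Reach G S u w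
  here _       ++ʳ q = q
  step s a p   ++ʳ q = step s a (p ++ʳ q)

  reverse : ∀ {S u v} → Reach G S u v → Reach G S v u
  reverse (here s)     = here s
  reverse (step s a p) = reverse p ++ʳ step (start-inside p) (sym G a) (here s)

  nonseparable-reach-avoiding : ∀ {T u v z} → Nonseparable G T → T u → T v → u ≢ z → v ≢ z →
                                Reach G (_≢ z) u v
  nonseparable-reach-avoiding {u = u} {v} {z} ((_ , connected) , no-cut) u∈T v∈T u≢z v≢z
    with connected u v u∈T v∈T
  ... | p with z ∈? vertices p
  ...   | no  z∉ = avoiding p z∉
  ...   | yes z∈ = weaken (λ _ → proj₂) (no-cut z (vertices-inside p z∈) u v (u∈T , u≢z) (v∈T , v≢z))

  Simple : ∀ {S u v} → Reach G S u v → Set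
  Simple (here _)         = ⊤
  Simple (step {u} _ _ p) = u ∉ vertices p × Simple p

  suffix-from : ∀ {S u w v} (p : Reach G S w v) → Simple p → u ∈ vertices p → Σ (Reach G S u v) Simple
  suffix-from (here s)     _        (here refl) = here s , tt
  suffix-from (step s a p) simple   (here refl) = step s a p , simple
  suffix-from (step _ _ p) (_ , simple) (there u∈) = suffix-from p simple u∈

  simplify : ∀ {S u v} → Reach G S u v → Σ (Reach G S u v) Simple
  simplify (here s) = here s , tt
  simplify (step {u} s a p) with simplify p
  ... | q , simple with u ∈? vertices q
  ...   | yes u∈ = suffix-from q simple u∈
  ...   | no  u∉ = step s a q , u∉ , simple

-- B is the block containing the edge ab.
module EdgeBlock {n} (G : Graph n) {a b : Fin n} (ab : Adj G a b) where
  open Walk G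
  open import Data.List.Membership.DecPropositional (_≟_ {n}) using (_∈?_)

  End : VSet n
  End e = e ≡ a ⊎ e ≡ b

  B : VSet n
  B v = ∀ z → v ≢ z → ∃ λ e → End e × Reach G (_≢ z) v e

  a∈B : B a
  a∈B _ a≢z = a , inj₁ refl , here a≢z

  b∈B : B b
  b∈B _ b≢z = b , inj₂ refl , here b≢z

  -- A vertex z on the rest of a simple walk is not the current vertex, so
  -- the next vertex can step back and follow the route that avoids z.
  simple-walk-inside-B : ∀ {S u e} (p : Reach G S u e) → Simple p → End e → B u →
                         Reach G (λ w → B w × S w) u e
  simple-walk-inside-B (here s) _ _ u∈B = here (u∈B , s)
  simple-walk-inside-B {e = e} (step {u} {w} s uw p) (u∉ , simple) end u∈B =
    step (u∈B , s) uw (simple-walk-inside-B p simple end w∈B)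
    where
    w∈B : B w
    w∈B z w≢z with z ∈? vertices p
    ... | no  z∉ = e , end , avoiding p z∉
    ... | yes z∈ =
      let (e′ , end′ , route) = u∈B z (λ u≡z → u∉ (subst (_∈ vertices p) (≡.sym u≡z) z∈))
      in e′ , end′ , step w≢z (sym G uw) route

  walk-to-end : ∀ {u} → B u → ∀ x → u ≢ x → ∃ λ e → End e × Reach G (λ w → B w × w ≢ x) u e
  walk-to-end u∈B x u≢x =
    let (e , end , p) = u∈B x u≢x
        (q , simple)  = simplify p
    in e , end , simple-walk-inside-B q simple end u∈B

  ends-adjacent : ∀ {e e′} → End e → End e′ → e ≢ e′ → Adj G e e′
  ends-adjacent (inj₁ refl) (inj₁ refl) e≢e′ = ⊥-elim (e≢e′ refl)
  ends-adjacent (inj₁ refl) (inj₂ refl) _    = ab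
  ends-adjacent (inj₂ refl) (inj₁ refl) _    = sym G ab
  ends-adjacent (inj₂ refl) (inj₂ refl) e≢e′ = ⊥-elim (e≢e′ refl)

  join-at-ends : ∀ {S u v e e′} → End e → End e′ → Reach G S u e → Reach G S v e′ → Reach G S u v
  join-at-ends {e = e} {e′} end end′ p q with e ≟ e′
  ... | yes refl = p ++ʳ reverse q
  ... | no e≢e′  = p ++ʳ step (end-inside p) (ends-adjacent end end′ e≢e′) (reverse q)

  walk-inside-B : ∀ {u} → B u → ∃ λ e → End e × Reach G B u e
  walk-inside-B {u} u∈B with u ≟ a
  ... | yes refl = a , inj₁ refl , here u∈B
  ... | no  u≢a  = let (e , end , p) = walk-to-end u∈B a u≢a in e , end , weaken (λ _ → proj₁) p

  B-nonseparable : Nonseparable G B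
  B-nonseparable = ((a , a∈B) , connected) , no-cut
    where
    connected : ∀ u v → B u → B v → Reach G B u v
    connected _ _ u∈B v∈B =
      let (_ , end , p) = walk-inside-B u∈B
          (_ , end′ , q) = walk-inside-B v∈B
      in join-at-ends end end′ p q
    no-cut : NoCutVertex G B
    no-cut x _ _ _ (u∈B , u≢x) (v∈B , v≢x) =
      let (_ , end , p) = walk-to-end u∈B x u≢x
          (_ , end′ , q) = walk-to-end v∈B x v≢x
      in join-at-ends end end′ p q

  B-maximal : ∀ T → B ⊆ᵥ T → Nonseparable G T → T ⊆ᵥ B
  B-maximal T B⊆T T-nonsep v v∈T z v≢z with z ≟ a
  ... | no  z≢a  =
    a , inj₁ refl , nonseparable-reach-avoiding T-nonsep v∈T (B⊆T a a∈B) v≢z (z≢a ∘ ≡.sym)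
  ... | yes refl =
    b , inj₂ refl , nonseparable-reach-avoiding T-nonsep v∈T (B⊆T b b∈B) v≢z (adjacent⇒≢ G ab ∘ ≡.sym)

  B-block : IsBlock G B
  B-block = B-nonseparable , B-maximal

C₄-Chorded : ∀ {n} → Graph n → Set
C₄-Chorded G = ∀ {a b c d} → a ≢ c → b ≢ d →
               Adj G a b → Adj G b c → Adj G c d → Adj G d a → Adj G a c

blockGraph⇒C₄-chorded : ∀ {n} {G : Graph n} → IsBlockGraph G → C₄-Chorded G
blockGraph⇒C₄-chorded {G = G} blocks-complete {a} {b} {c} {d} a≢c b≢d ab bc cd da =
  blocks-complete B B-block a c a∈B c∈B a≢c
  where
  open EdgeBlock G ab
  c∈B : B c
  c∈B z c≢z with z ≟ b
  ... | no  z≢b  = b , inj₂ refl , step c≢z (sym G bc) (here (z≢b ∘ ≡.sym))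
  ... | yes refl = a , inj₁ refl , step c≢z cd (step (b≢d ∘ ≡.sym) da (here (adjacent⇒≢ G ab)))

module _ {n} (G : Graph n) (x : Fin n) {P C : Pred (Fin n) 0ℓ} (P? : Decidable P) (C? : Decidable C) where

  ConeEdge : Fin n → Fin n → Set
  ConeEdge u w = (u ≡ x × (P w ⊎ C w)) ⊎ (w ≡ x × (P u ⊎ C u)) ⊎ (C u × C w)

  cone : ¬ P x → ¬ C x → (∀ {z} → P z → ¬ C z) → (∀ {z} → P z ⊎ C z → Adj G x z) →
         (∀ {u w} → C u → C w → u ≢ w → Adj G u w) → ThresholdSubgraph G
  cone ¬Px ¬Cx P∩C apex clique = record
    { verts     = x ∷ Ps ++ Cs
    ; E         = E
    ; E-sym     = λ where
        (uw , inj₁ x-w)               → sym G uw , inj₂ (inj₁ x-w)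
        (uw , inj₂ (inj₁ x-u))        → sym G uw , inj₁ x-u
        (uw , inj₂ (inj₂ (Cu , Cw))) → sym G uw , inj₂ (inj₂ (Cw , Cu))
    ; E-sub     = proj₁
    ; E-verts   = λ where
        (_ , inj₁ (refl , w∈))        → here refl , there (∈PC⁺ w∈)
        (_ , inj₂ (inj₁ (refl , u∈))) → there (∈PC⁺ u∈) , here refl
        (_ , inj₂ (inj₂ (Cu , Cw)))   → there (∈PC⁺ (inj₂ Cu)) , there (∈PC⁺ (inj₂ Cw))
    ; threshold = ∷-universal
        (++-isolated Ps (Unique.++⁺ (unique P?) (unique C?) disjoint) isolated
                     (clique⁰ Cs (unique C?) λ u w u∈ w∈ u≢w → let Cu = ∈C u∈ ; Cw = ∈C w∈ in
                                                              clique Cu Cw u≢w , inj₂ (inj₂ (Cu , Cw))))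
        (λ x∈ → [ ¬Px , ¬Cx ] (∈PC⁻ x∈))
        (λ w w∈ → apex (∈PC⁻ w∈) , inj₁ (refl , ∈PC⁻ w∈))
    }
    where
    E : Fin n → Fin n → Set
    E u w = Adj G u w × ConeEdge u w

    Ps Cs : List (Fin n)
    Ps = filter P? (allFin n)
    Cs = filter C? (allFin n)

    unique : ∀ {Q : Pred (Fin n) 0ℓ} (Q? : Decidable Q) → Unique (filter Q? (allFin n))
    unique Q? = Unique.filter⁺ Q? (Unique.allFin⁺ n)

    ∈P : ∀ {z} → z ∈ Ps → P z
    ∈P z∈ = proj₂ (∈-filter⁻ P? {xs = allFin n} z∈)

    ∈C : ∀ {z} → z ∈ Cs → C z
    ∈C z∈ = proj₂ (∈-filter⁻ C? {xs = allFin n} z∈)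

    ∈PC⁻ : ∀ {z} → z ∈ Ps ++ Cs → P z ⊎ C z
    ∈PC⁻ z∈ = Sum.map ∈P ∈C (∈-++⁻ Ps z∈)

    ∈PC⁺ : ∀ {z} → P z ⊎ C z → z ∈ Ps ++ Cs
    ∈PC⁺ (inj₁ Pz) = ∈-++⁺ˡ (∈-filter⁺ P? (∈-allFin _) Pz)
    ∈PC⁺ (inj₂ Cz) = ∈-++⁺ʳ Ps (∈-filter⁺ C? (∈-allFin _) Cz)

    disjoint : ∀ {z} → z ∈ Ps × z ∈ Cs → ⊥
    disjoint (z∈P , z∈C) = P∩C (∈P z∈P) (∈C z∈C)

    isolated : ∀ u w → u ∈ Ps → w ∈ Ps ++ Cs → ¬ E u w
    isolated u w u∈ w∈ (_ , inj₁ (refl , _))        = ¬Px (∈P u∈)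
    isolated u w u∈ w∈ (_ , inj₂ (inj₁ (refl , _))) = [ ¬Px , ¬Cx ] (∈PC⁻ w∈)
    isolated u w u∈ w∈ (_ , inj₂ (inj₂ (Cu , _)))   = P∩C (∈P u∈) Cu

module CoIntervalCover {n} (G : Graph n) (chorded : C₄-Chorded G)
                       (adj? : ∀ u w → Dec (Adj G u w))
                       (l h : Fin n → ℚ) (l≤h : ∀ v → l v ℚ.≤ h v)
                       (before⇒adj : ∀ {u w} → h u ℚ.< l w → Adj G u w)
                       (x : Fin n) (hx≤h : ∀ v → h x ℚ.≤ h v) (y : Fin n) (l≤ly : ∀ v → l v ℚ.≤ l y) where

  ¬before-self : ∀ {v} → ¬ h v ℚ.< l v
  ¬before-self {v} hv<lv = <⇒≱ℚ hv<lv (l≤h v)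

  star : ThresholdSubgraph G
  star = cone G y (λ z → h z ℚ.<? l y) (λ _ → no id)
    ¬before-self id (λ _ ()) [ sym G ∘ before⇒adj , (λ ()) ] (λ ())

  Common : Pred (Fin n) 0ℓ
  Common z = Adj G x y × Adj G x z × Adj G y z

  common? : Decidable Common
  common? z = adj? x y ×-dec adj? x z ×-dec adj? y z

  Pendant : Pred (Fin n) 0ℓ
  Pendant z = h x ℚ.< l z × ¬ Common z

  fan : ThresholdSubgraph G
  fan = cone G x (λ z → (h x ℚ.<? l z) ×-dec ¬? (common? z)) common?
    (¬before-self ∘ proj₁) (λ (_ , xx , _) → irrefl G xx) proj₂
    [ before⇒adj ∘ proj₁ , proj₁ ∘ proj₂ ]
    (λ (xy , xu , yu) (_ , xw , yw) u≢w → chorded u≢w (adjacent⇒≢ G xy) (sym G xu) xw (sym G yw) yu)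

  parts : Fin 2 → ThresholdSubgraph G
  parts zero       = star
  parts (suc zero) = fan

  -- For u ≠ x and w ≠ y, the 4-cycles x w u y and w u y x give the chords
  -- xu and wy.
  coInterval-cover : ∀ {u w} → h u ℚ.< l w → ∃ λ j → ThresholdSubgraph.E (parts j) u w
  coInterval-cover {u} {w} u<w with w ≟ y | u ≟ x
  ... | yes refl | _        = zero , before⇒adj u<w , inj₂ (inj₁ (refl , inj₁ u<w))
  ... | no _     | yes refl = suc zero , before⇒adj u<w , inj₁ (refl , pendant-or-common (common? w))
    where
    pendant-or-common : Dec (Common w) → Pendant w ⊎ Common w
    pendant-or-common (yes c) = inj₂ c
    pendant-or-common (no ¬c) = inj₁ (u<w , ¬c)
  ... | no w≢y   | no u≢x   = suc zero , uw , inj₂ (inj₂ ((xy , xu , sym G uy) , (xy , xw , sym G wy)))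
    where
    uw : Adj G u w
    uw = before⇒adj u<w
    xw : Adj G x w
    xw = before⇒adj (ℚₚ.≤-<-trans (hx≤h u) u<w)
    uy : Adj G u y
    uy = before⇒adj (ℚₚ.<-≤-trans u<w (l≤ly w))
    xy : Adj G x y
    xy = before⇒adj (ℚₚ.≤-<-trans (hx≤h u) (ℚₚ.<-≤-trans u<w (l≤ly w)))
    xu : Adj G x u
    xu = chorded (u≢x ∘ ≡.sym) w≢y xw (sym G uw) uy (sym G xy)
    wy : Adj G w y
    wy = chorded w≢y u≢x (sym G uw) uy (sym G xy) xw

module _ {n} {G : Graph n} {b} (R : BoxRep (complement G) b) where
  open BoxRep R

  separated⇒adjacent : (∀ u w → Dec (Adj G u w)) → ∀ i {u w} → hi u i ℚ.< lo w i → Adj G u w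
  separated⇒adjacent adj? i {u} {w} u<w with adj? u w
  ... | yes uw = uw
  ... | no ¬uw = ⊥-elim (<⇒≱ℚ u<w (proj₂ (Equivalence.to (represents u w u≢w) (u≢w , ¬uw) i)))
    where
    u≢w : u ≢ w
    u≢w refl = <⇒≱ℚ u<w (wf u i)

  overlap? : ∀ u w i → Dec (lo u i ℚ.≤ hi w i × lo w i ℚ.≤ hi u i)
  overlap? u w i = (lo u i ℚ.≤? hi w i) ×-dec (lo w i ℚ.≤? hi u i)

  adjacent⇒separated : ∀ {u w} → Adj G u w → ∃ λ i → hi u i ℚ.< lo w i ⊎ hi w i ℚ.< lo u i
  adjacent⇒separated {u} {w} uw with all? (overlap? u w)
  ... | yes overlaps = ⊥-elim (proj₂ (Equivalence.from (represents u w (adjacent⇒≢ G uw)) overlaps) uw)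
  ... | no ¬overlaps with ¬∀⟶∃¬ b _ (overlap? u w) ¬overlaps
  ...   | i , ¬overlap with lo u i ℚ.≤? hi w i
  ...     | no  ¬lu≤hw = i , inj₂ (ℚₚ.≰⇒> ¬lu≤hw)
  ...     | yes lu≤hw  = i , inj₁ (ℚₚ.≰⇒> (λ lw≤hu → ¬overlap (lu≤hw , lw≤hu)))

minimiser : ∀ {m} (f : Fin (suc m) → ℚ) → ∃ λ x → ∀ v → f x ℚ.≤ f v
minimiser f =
  argmin f zero (allFin _) , λ v → All.lookup (f[argmin]≤f[xs] {f = f} zero (allFin _)) (∈-allFin v)

maximiser : ∀ {m} (f : Fin (suc m) → ℚ) → ∃ λ y → ∀ v → f v ℚ.≤ f y
maximiser f =
  argmax f zero (allFin _) , λ v → All.lookup (f[xs]≤f[argmax] {f = f} zero (allFin _)) (∈-allFin v)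

productCover : ∀ {n} {G : Graph n} {k l} (T : Fin k → Fin l → ThresholdSubgraph G) →
               (∀ u v → Adj G u v → ∃₂ λ i j → ThresholdSubgraph.E (T i j) u v) → ThresholdCover G (k * l)
productCover {l = l} T covers = record
  { part  = uncurry T ∘ remQuot l
  ; cover = λ u v uv → let (i , j , e) = covers u v uv in
      combine i j , subst (λ ij → ThresholdSubgraph.E (uncurry T ij) u v) (≡.sym (remQuot-combine i j)) e
  }

coordinate-cover : ∀ {m} {G : Graph (suc m)} {b} → C₄-Chorded G → (∀ u w → Dec (Adj G u w)) →
                   (R : BoxRep (complement G) b) (i : Fin b) → let open BoxRep R in
                   Σ (Fin 2 → ThresholdSubgraph G) λ T →
                     ∀ {u w} → hi u i ℚ.< lo w i → ∃ λ j → ThresholdSubgraph.E (T j) u w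
coordinate-cover {G = G} chorded adj? R i = parts , coInterval-cover
  where
  open BoxRep R
  first-end : ∃ λ x → ∀ v → hi x i ℚ.≤ hi v i
  first-end = minimiser (λ v → hi v i)
  last-start : ∃ λ y → ∀ v → lo v i ℚ.≤ lo y i
  last-start = maximiser (λ v → lo v i)
  open CoIntervalCover G chorded adj? (λ v → lo v i) (λ v → hi v i) (λ v → wf v i)
                       (separated⇒adjacent {G = G} R adj? i)
                       (proj₁ first-end) (proj₂ first-end) (proj₁ last-start) (proj₂ last-start)

boxRep⇒thresholdCover : ∀ {m} {G : Graph (suc m)} {b} → C₄-Chorded G → (∀ u w → Dec (Adj G u w)) →
                        BoxRep (complement G) b → ThresholdCover G (2 * b)
boxRep⇒thresholdCover {G = G} {b} chorded adj? R =
  productCover T (λ _ _ → separated-covered ∘ adjacent⇒separated {G = G} R)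
  where
  open BoxRep R
  T : Fin 2 → Fin b → ThresholdSubgraph G
  T j i = proj₁ (coordinate-cover chorded adj? R i) j
  separated-covered : ∀ {u v} → (∃ λ i → hi u i ℚ.< lo v i ⊎ hi v i ℚ.< lo u i) →
                      ∃₂ λ j i → ThresholdSubgraph.E (T j i) u v
  separated-covered (i , inj₁ u<v) =
    let (j , e) = proj₂ (coordinate-cover chorded adj? R i) u<v in j , i , e
  separated-covered (i , inj₂ v<u) =
    let (j , e) = proj₂ (coordinate-cover chorded adj? R i) v<u in j , i , ThresholdSubgraph.E-sym (T j i) e

¬¬-decidable₂ : ∀ {n} (R : Fin n → Fin n → Set) → ¬ ¬ (∀ u v → Dec (R u v))
¬¬-decidable₂ R = sequence ¬¬-applicative (λ u → sequence ¬¬-applicative (λ v → ¬¬-excluded-middle))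
  where
  ¬¬-applicative : RawApplicative {0ℓ} DoubleNegation
  ¬¬-applicative = RawMonad.rawApplicative ¬¬-Monad

cobox≤cothdim : ∀ {n} {G : Graph n} {b t} → IsCoBoxicity G b → IsCoThresholdDim G t → b ≤ t
cobox≤cothdim (_ , minimal) (cover , _) = minimal _ (thresholdCover⇒boxRep cover)

-- Adjacency need not be decidable, but t ≤ 2b is, so we may assume it is.
cothdim≤2*cobox : ∀ {n} {G : Graph n} → IsBlockGraph G → ∀ {b t} →
                  IsCoBoxicity G b → IsCoThresholdDim G t → t ≤ 2 * b
cothdim≤2*cobox {zero} _ _ (_ , minimal) =
  ≤-trans (minimal 0 (record { part = λ () ; cover = λ () })) z≤n
cothdim≤2*cobox {suc _} {G} blocks-complete {b} {t} (box , _) (_ , minimal) =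
  decidable-stable (t ≤? 2 * b)
    (¬¬-map (λ adj? → minimal _ (boxRep⇒thresholdCover chorded adj? box)) (¬¬-decidable₂ (Adj G)))
  where
  chorded : C₄-Chorded G
  chorded = blockGraph⇒C₄-chorded blocks-complete

proposition1 : ∀ (n : ℕ) (G : Graph n) → IsBlockGraph G →
    ∀ (b t : ℕ) → IsCoBoxicity G b → IsCoThresholdDim G t →
    (b ≤ t) × (t ≤ 2 * b)
proposition1 _ _ blockGraph _ _ cobox cothdim =
  cobox≤cothdim cobox cothdim , cothdim≤2*cobox blockGraph cobox cothdim
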